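{- Let $p$ be a prime and let $k$ be a positive divisor of $p-1$. Then $$\sum_{h\mid k} T((p-1)/h,p)\le \#X(k,p).$$
   Context: For a positive divisor $d$ of $p-1$ and $k=(p-1)/d$ define $X^*(k,p)=\{x\in\mathbb{Z}~:~1\le x\le k,\ (x,k)=1,\ x^k\equiv(-k)^k\pmod p\}$, $X(k,p)=\{x\in\mathbb{Z}~:~1\le x\le k,\ x^k\equiv(-k)^k\pmod p\}$, and $T(d,p)=\#X^*(k,p)$. Here $(x,k)$ is the greatest common divisor. -}

module Defs where

open import Data.Nat using (ℕ; suc; _∸_; _/_; NonZero; _≟_)
open import Data.Nat.Divisibility using (_∣_; _∣?_)
open import Data.Nat.GCD using (gcd)
open import Data.Integer as ℤ using (ℤ; +_; -_; _-_; ∣_∣)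
open import Data.List using (List; filter; length; map)
open import Data.Nat.ListAction using (sum)
open import Data.List.Base using (upTo)
open import Relation.Nullary.Decidable using (_×-dec_)

range1 : ℕ → List ℕ
range1 n = map suc (upTo n)

Cong : ℕ → ℕ → ℕ → Set
Cong p k x = p ∣ ∣ (+ x) ℤ.^ k - (- (+ k)) ℤ.^ k ∣

X : ℕ → ℕ → List ℕ
X k p = filter (λ x → p ∣? ∣ (+ x) ℤ.^ k - (- (+ k)) ℤ.^ k ∣) (range1 k)

X* : ℕ → ℕ → List ℕ
X* k p = filter (λ x → (gcd x k ≟ 1) ×-dec (p ∣? ∣ (+ x) ℤ.^ k - (- (+ k)) ℤ.^ k ∣)) (range1 k)

T : (d p : ℕ) → .{{NonZero d}} → ℕ
T d p = length (X* ((p ∸ 1) / d) p)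


-- T extended by 0 at d = 0 (only used where d = (p-1)/h ≥ 1, so it agrees with T)
T₀ : ℕ → ℕ → ℕ
T₀ 0 p = 0
T₀ (suc d) p = T (suc d) p

sumT : ℕ → ℕ → ℕ
-- h ranges over suc i for i < k with (suc i) ∣ k, i.e. over the positive divisors of k
sumT k p = sum (map (λ i → T₀ ((p ∸ 1) / suc i) p) (filter (λ i → suc i ∣? k) (upTo k)))

{-# OPTIONS --safe #-}
module Submission where

-- For every divisor h of k, put m = k / h. Since x ^ h ≡ (-h) ^ h (mod p) implies
-- (x m) ^ (h m) ≡ (-(h m)) ^ (h m) (mod p), the map x ↦ x m sends X*(h,p) injectively into
-- X(k,p), and T((p-1)/h,p) = #X*(h,p). For x coprime to h we have gcd(x m, k) = m,
-- so the images for different h are disjoint and together fit inside X(k,p).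

open import Defs
open import Data.Nat using (ℕ; _∸_; _≤_; NonZero)
open import Data.Nat.Divisibility using (_∣_)
open import Data.Nat.Primality using (Prime)
open import Data.List using (length)

open import Function using (_∘_)
open import Data.Nat as ℕ using (zero; suc; _*_; _/_; z≤n; s≤s; _≟_; >-nonZero; >-nonZero⁻¹)
open import Data.Nat.Properties
  using ( suc-injective; *-mono-≤; *-monoˡ-≤; ≤-reflexive; +-mono-≤; *-comm; *-cancelʳ-≡; *-identityʳ
        ; module ≤-Reasoning)
open import Data.Nat.Divisibility using (_∣?_; ∣-trans; ∣⇒≤)
open import Data.Nat.DivMod using (m*[n/m]≡n; m*n/n≡m; m≥n⇒m/n>0)
open import Data.Nat.GCD using (gcd; c*gcd[m,n]≡gcd[cm,cn])
open import Data.Nat.ListAction using (sum)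
open import Data.Integer as ℤ using (+_; -_; _-_; ∣_∣)
open import Data.Integer.Properties using (pos-*; neg-distribˡ-*; ^-*-assoc; *-zeroˡ)
open import Data.Integer.Divisibility.Signed as ℤ∣
  using (∣-refl; ∣ᵤ⇒∣; ∣⇒∣ᵤ; ∣m∣n⇒∣m+n; ∣m⇒∣m*n; ∣n⇒∣m*n)
open import Data.Integer.Solver using (module +-*-Solver)
open import Data.List using (List; []; _∷_; map; filter; upTo; concatMap)
open import Data.List.Properties using (length-++; length-map; length-removeAt′)
open import Data.List.Membership.Propositional using (_∈_)
open import Data.List.Membership.Propositional.Properties
  using (∈-map⁺; ∈-map⁻; ∈-concat⁻′; ∈-filter⁺; ∈-filter⁻; ∈-upTo⁺; ∈-upTo⁻)
open import Data.List.Relation.Binary.Subset.Propositional using (_⊆_)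
open import Data.List.Relation.Binary.Disjoint.Propositional using (Disjoint)
open import Data.List.Relation.Unary.Any using (here; there; _─_)
open import Data.List.Relation.Unary.All as All using (All; []; _∷_)
open import Data.List.Relation.Unary.All.Properties as All using (all-filter)
open import Data.List.Relation.Unary.AllPairs using (AllPairs; []; _∷_)
open import Data.List.Relation.Unary.Unique.Propositional using (Unique)
import Data.List.Relation.Unary.Unique.Propositional.Properties as Unique
open import Data.Product using (_×_; _,_; proj₁; proj₂)
open import Relation.Nullary using (contradiction)
open import Relation.Nullary.Decidable using (_×-dec_)
open import Relation.Binary.PropositionalEquality

^-distribʳ-* : ∀ i j n → (i ℤ.* j) ℤ.^ n ≡ i ℤ.^ n ℤ.* j ℤ.^ n
^-distribʳ-* i j zero = refl
^-distribʳ-* i j (suc n) = begin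
  (i ℤ.* j) ℤ.* (i ℤ.* j) ℤ.^ n
    ≡⟨ cong ((i ℤ.* j) ℤ.*_) (^-distribʳ-* i j n) ⟩
  (i ℤ.* j) ℤ.* (i ℤ.^ n ℤ.* j ℤ.^ n)
    ≡⟨ solve 4 (λ i j iⁿ jⁿ → (i :* j) :* (iⁿ :* jⁿ) := (i :* iⁿ) :* (j :* jⁿ)) refl i j (i ℤ.^ n) (j ℤ.^ n) ⟩
  (i ℤ.* i ℤ.^ n) ℤ.* (j ℤ.* j ℤ.^ n) ∎
  where open ≡-Reasoning; open +-*-Solver

i-j∣iⁿ-jⁿ : ∀ i j n → (i - j) ℤ∣.∣ (i ℤ.^ n - j ℤ.^ n)
i-j∣iⁿ-jⁿ i j zero = ℤ∣.divides (+ 0) (sym (*-zeroˡ (i - j)))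
i-j∣iⁿ-jⁿ i j (suc n) = subst ((i - j) ℤ∣.∣_) telescope
  (∣m∣n⇒∣m+n (∣n⇒∣m*n i (i-j∣iⁿ-jⁿ i j n)) (∣m⇒∣m*n (j ℤ.^ n) ∣-refl))
  where
  open +-*-Solver
  telescope : i ℤ.* (i ℤ.^ n - j ℤ.^ n) ℤ.+ (i - j) ℤ.* j ℤ.^ n
            ≡ i ℤ.* i ℤ.^ n - j ℤ.* j ℤ.^ n
  telescope = solve 4 (λ i j iⁿ jⁿ → i :* (iⁿ :- jⁿ) :+ (i :- j) :* jⁿ := i :* iⁿ :- j :* jⁿ)
                refl i j (i ℤ.^ n) (j ℤ.^ n)

power-of-scaled : ∀ a m h → (a ℤ.* + m) ℤ.^ (h * m) ≡ (a ℤ.^ h) ℤ.^ m ℤ.* (+ m) ℤ.^ (h * m)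
power-of-scaled a m h =
  trans (^-distribʳ-* a (+ m) (h * m)) (cong (ℤ._* (+ m) ℤ.^ (h * m)) (sym (^-*-assoc a h m)))

Cong-scale : ∀ {p h x} m → Cong p h x → Cong p (h * m) (x * m)
Cong-scale {p} {h} {x} m p∣ = ∣⇒∣ᵤ (subst (+ p ℤ∣.∣_) (sym difference)
  (∣m⇒∣m*n c (ℤ∣.∣-trans (∣ᵤ⇒∣ {+ p} p∣) (i-j∣iⁿ-jⁿ (a ℤ.^ h) (b ℤ.^ h) m))))
  where
  a = + x
  b = - (+ h)
  c = (+ m) ℤ.^ (h * m)
  difference : (+ (x * m)) ℤ.^ (h * m) - (- + (h * m)) ℤ.^ (h * m)
             ≡ ((a ℤ.^ h) ℤ.^ m - (b ℤ.^ h) ℤ.^ m) ℤ.* c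
  difference = begin
    (+ (x * m)) ℤ.^ (h * m) - (- + (h * m)) ℤ.^ (h * m)
      ≡⟨ cong₂ (λ u v → u ℤ.^ (h * m) - v ℤ.^ (h * m))
               (pos-* x m) (trans (cong -_ (pos-* h m)) (neg-distribˡ-* (+ h) (+ m))) ⟩
    (a ℤ.* + m) ℤ.^ (h * m) - (b ℤ.* + m) ℤ.^ (h * m)
      ≡⟨ cong₂ _-_ (power-of-scaled a m h) (power-of-scaled b m h) ⟩
    (a ℤ.^ h) ℤ.^ m ℤ.* c - (b ℤ.^ h) ℤ.^ m ℤ.* c
      ≡⟨ solve 3 (λ u v c → u :* c :- v :* c := (u :- v) :* c) refl
                 ((a ℤ.^ h) ℤ.^ m) ((b ℤ.^ h) ℤ.^ m) c ⟩
    ((a ℤ.^ h) ℤ.^ m - (b ℤ.^ h) ℤ.^ m) ℤ.* c ∎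
    where open ≡-Reasoning; open +-*-Solver

∈-─⁺ : ∀ {A : Set} {x y : A} {ys} (x∈ys : x ∈ ys) → y ∈ ys → y ≢ x → y ∈ (ys ─ x∈ys)
∈-─⁺ (here refl) (here refl) y≢x = contradiction refl y≢x
∈-─⁺ (here refl) (there y∈ys) y≢x = y∈ys
∈-─⁺ (there x∈ys) (here refl) y≢x = here refl
∈-─⁺ (there x∈ys) (there y∈ys) y≢x = there (∈-─⁺ x∈ys y∈ys y≢x)

Unique-⊆⇒length-≤ : ∀ {A : Set} {xs ys : List A} → Unique xs → xs ⊆ ys → length xs ≤ length ys
Unique-⊆⇒length-≤ {xs = []} _ _ = z≤n
Unique-⊆⇒length-≤ {xs = x ∷ xs} {ys} (x∉xs ∷ xs!) xs⊆ys = begin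
  suc (length xs)          ≤⟨ s≤s (Unique-⊆⇒length-≤ xs! xs⊆ys─x) ⟩
  suc (length (ys ─ x∈ys)) ≡⟨ length-removeAt′ ys _ ⟨
  length ys                ∎
  where
  open ≤-Reasoning
  x∈ys = xs⊆ys (here refl)
  xs⊆ys─x : xs ⊆ (ys ─ x∈ys)
  xs⊆ys─x y∈xs = ∈-─⁺ x∈ys (xs⊆ys (there y∈xs)) (λ { refl → All.lookup x∉xs y∈xs refl })

length-concatMap : ∀ {A B : Set} (f : A → List B) xs →
  length (concatMap f xs) ≡ sum (map (length ∘ f) xs)
length-concatMap f [] = refl
length-concatMap f (x ∷ xs) =
  trans (length-++ (f x)) (cong (length (f x) ℕ.+_) (length-concatMap f xs))

sum-map-mono-≤ : ∀ {A : Set} {f g : A → ℕ} {xs} →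
  All (λ x → f x ≤ g x) xs → sum (map f xs) ≤ sum (map g xs)
sum-map-mono-≤ [] = z≤n
sum-map-mono-≤ (fx≤gx ∷ f≤g) = +-mono-≤ fx≤gx (sum-map-mono-≤ f≤g)

concatMap-⊆ : ∀ {A B : Set} {F : A → List B} {xs ys} →
  (∀ {x} → x ∈ xs → F x ⊆ ys) → concatMap F xs ⊆ ys
concatMap-⊆ {F = F} {xs} F⊆ys y∈ with ∈-concat⁻′ (map F xs) y∈
... | _ , y∈Fx , Fx∈ with ∈-map⁻ F Fx∈
... | _ , x∈xs , refl = F⊆ys x∈xs y∈Fx

Unique-concatMap : ∀ {A B : Set} {F : A → List B} {xs} →
  Unique xs → (∀ {x} → x ∈ xs → Unique (F x)) →
  (∀ {x x′ y} → x ∈ xs → x′ ∈ xs → y ∈ F x → y ∈ F x′ → x ≡ x′) → Unique (concatMap F xs)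
Unique-concatMap {F = F} xs! F! separated =
  Unique.concat⁺ (All.map⁺ (All.tabulate F!)) (disjoint xs! separated)
  where
  disjoint : ∀ {xs} → Unique xs → (∀ {x x′ y} → x ∈ xs → x′ ∈ xs → y ∈ F x → y ∈ F x′ → x ≡ x′) →
    AllPairs Disjoint (map F xs)
  disjoint [] _ = []
  disjoint (x∉xs ∷ xs!) separated =
    All.map⁺ (All.tabulate (λ x′∈xs (y∈Fx , y∈Fx′) →
      All.lookup x∉xs x′∈xs (separated (here refl) (there x′∈xs) y∈Fx y∈Fx′)))
    ∷ disjoint xs! (λ x∈ x′∈ → separated (there x∈) (there x′∈))

gcd-*-coprime : ∀ x h m → gcd x h ≡ 1 → gcd (x * m) (h * m) ≡ m
gcd-*-coprime x h m gcd[x,h]≡1 = begin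
  gcd (x * m) (h * m) ≡⟨ cong₂ gcd (*-comm x m) (*-comm h m) ⟩
  gcd (m * x) (m * h) ≡⟨ c*gcd[m,n]≡gcd[cm,cn] m x h ⟨
  m * gcd x h         ≡⟨ cong (m *_) gcd[x,h]≡1 ⟩
  m * 1               ≡⟨ *-identityʳ m ⟩
  m                   ∎
  where open ≡-Reasoning

m/n≡o⇒m/o≡n : ∀ {m n o} .{{_ : NonZero n}} .{{_ : NonZero o}} → n ∣ m → m / n ≡ o → m / o ≡ n
m/n≡o⇒m/o≡n {m} {n} {o} n∣m m/n≡o = begin
  m / o           ≡⟨ cong (_/ o) (m*[n/m]≡n n∣m) ⟨
  n * (m / n) / o ≡⟨ cong (λ q → n * q / o) m/n≡o ⟩
  n * o / o       ≡⟨ m*n/n≡m n o ⟩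
  n               ∎
  where open ≡-Reasoning

/-nonZero : ∀ {m n} .{{_ : NonZero m}} .{{_ : NonZero n}} → n ∣ m → NonZero (m / n)
/-nonZero n∣m = >-nonZero (m≥n⇒m/n>0 (∣⇒≤ n∣m))

m/n≡m/o⇒n≡o : ∀ {m n o} .{{_ : NonZero m}} .{{_ : NonZero n}} .{{_ : NonZero o}} →
  n ∣ m → o ∣ m → m / n ≡ m / o → n ≡ o
m/n≡m/o⇒n≡o {m} {n} {o} n∣m o∣m m/n≡m/o = *-cancelʳ-≡ n o (m / n) {{/-nonZero n∣m}} (begin
  n * (m / n) ≡⟨ m*[n/m]≡n n∣m ⟩
  m           ≡⟨ m*[n/m]≡n o∣m ⟨
  o * (m / o) ≡⟨ cong (o *_) m/n≡m/o ⟨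
  o * (m / n) ∎)
  where open ≡-Reasoning

∈-range1⁺ : ∀ {n y} → 1 ≤ y → y ≤ n → y ∈ range1 n
∈-range1⁺ {y = suc y} (s≤s z≤n) y≤n = ∈-map⁺ suc (∈-upTo⁺ y≤n)

∈-range1⁻ : ∀ {n y} → y ∈ range1 n → 1 ≤ y × y ≤ n
∈-range1⁻ y∈ with ∈-map⁻ suc y∈
... | _ , i∈upTo , refl = s≤s z≤n , ∈-upTo⁻ i∈upTo

∈-X⁺ : ∀ {k p y} → 1 ≤ y → y ≤ k → Cong p k y → y ∈ X k p
∈-X⁺ {k} {p} 1≤y y≤k y^k≡ =
  ∈-filter⁺ (λ y → p ∣? ∣ (+ y) ℤ.^ k - (- (+ k)) ℤ.^ k ∣) (∈-range1⁺ 1≤y y≤k) y^k≡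

∈-X*⁻ : ∀ {h p x} → x ∈ X* h p → (1 ≤ x × x ≤ h) × gcd x h ≡ 1 × Cong p h x
∈-X*⁻ {h} {p} x∈
  with ∈-filter⁻ (λ x → (gcd x h ≟ 1) ×-dec (p ∣? ∣ (+ x) ℤ.^ h - (- (+ h)) ℤ.^ h ∣)) x∈
... | x∈range , coprime = ∈-range1⁻ x∈range , coprime

X*-Unique : ∀ h p → Unique (X* h p)
X*-Unique h p = Unique.filter⁺ (λ x → (gcd x h ≟ 1) ×-dec (p ∣? ∣ (+ x) ℤ.^ h - (- (+ h)) ℤ.^ h ∣))
  (Unique.map⁺ suc-injective (Unique.upTo⁺ h))

scaledX* : ℕ → ℕ → ℕ → List ℕ
scaledX* p h m = map (_* m) (X* h p)

scaledX*⊆X : ∀ {p h} m .{{_ : NonZero m}} → scaledX* p h m ⊆ X (h * m) p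
scaledX*⊆X {p} {h} m y∈ with ∈-map⁻ (_* m) y∈
... | x , x∈X* , refl with ∈-X*⁻ {h} {p} x∈X*
... | (1≤x , x≤h) , _ , x^h≡ =
  ∈-X⁺ {h * m} {p} (*-mono-≤ 1≤x (>-nonZero⁻¹ m)) (*-monoˡ-≤ m x≤h)
    (Cong-scale {p} {h} {x} m x^h≡)

scaledX*-Unique : ∀ p h m .{{_ : NonZero m}} → Unique (scaledX* p h m)
scaledX*-Unique p h m = Unique.map⁺ (λ {x} {x′} → *-cancelʳ-≡ x x′ m) (X*-Unique h p)

gcd-scaledX* : ∀ {p h m y} → y ∈ scaledX* p h m → gcd y (h * m) ≡ m
gcd-scaledX* {p} {h} {m} y∈ with ∈-map⁻ (_* m) y∈
... | x , x∈X* , refl = gcd-*-coprime x h m (proj₁ (proj₂ (∈-X*⁻ {h} {p} x∈X*)))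

T₀-≤-#X* : ∀ p h .{{_ : NonZero h}} → h ∣ p ∸ 1 → T₀ ((p ∸ 1) / h) p ≤ length (X* h p)
T₀-≤-#X* p h h∣p-1 with (p ∸ 1) / h in eq
... | zero  = z≤n
... | suc _ = ≤-reflexive (cong (λ d → length (X* d p)) (m/n≡o⇒m/o≡n h∣p-1 eq))

-- The index i stands for the divisor suc i of k, as in sumT.
module DivisorImages (p k : ℕ) .{{_ : NonZero k}} where

  D : List ℕ
  D = filter (λ i → suc i ∣? k) (upTo k)

  D∣k : All (λ i → suc i ∣ k) D
  D∣k = all-filter (λ i → suc i ∣? k) (upTo k)

  D-Unique : Unique D
  D-Unique = Unique.filter⁺ (λ i → suc i ∣? k) (Unique.upTo⁺ k)

  F : ℕ → List ℕ
  F i = scaledX* p (suc i) (k / suc i)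

  T₀≤#F : ∀ {i} → k ∣ p ∸ 1 → suc i ∣ k → T₀ ((p ∸ 1) / suc i) p ≤ length (F i)
  T₀≤#F {i} k∣p-1 i+1∣k = subst (T₀ ((p ∸ 1) / suc i) p ≤_)
    (sym (length-map (_* (k / suc i)) (X* (suc i) p)))
    (T₀-≤-#X* p (suc i) (∣-trans i+1∣k k∣p-1))

  F⊆X : ∀ {i} → i ∈ D → F i ⊆ X k p
  F⊆X {i} i∈D = subst (λ n → F i ⊆ X n p) (m*[n/m]≡n i+1∣k)
    (scaledX*⊆X {p} {suc i} (k / suc i) {{/-nonZero i+1∣k}})
    where i+1∣k = All.lookup D∣k i∈D

  F-Unique : ∀ {i} → i ∈ D → Unique (F i)
  F-Unique {i} i∈D =
    scaledX*-Unique p (suc i) (k / suc i) {{/-nonZero (All.lookup D∣k i∈D)}}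

  gcd-F : ∀ {i y} → i ∈ D → y ∈ F i → gcd y k ≡ k / suc i
  gcd-F {i} {y} i∈D y∈Fi = subst (λ n → gcd y n ≡ k / suc i) (m*[n/m]≡n (All.lookup D∣k i∈D))
    (gcd-scaledX* {p} {suc i} y∈Fi)

  F-separated : ∀ {i j y} → i ∈ D → j ∈ D → y ∈ F i → y ∈ F j → i ≡ j
  F-separated i∈D j∈D y∈Fi y∈Fj = suc-injective
    (m/n≡m/o⇒n≡o (All.lookup D∣k i∈D) (All.lookup D∣k j∈D)
      (trans (sym (gcd-F i∈D y∈Fi)) (gcd-F j∈D y∈Fj)))

lemma5p1 : (p k : ℕ) → Prime p → .{{_ : NonZero k}} → k ∣ (p ∸ 1) →
    sumT k p ≤ length (X k p)
lemma5p1 p k _ k∣p-1 = begin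
  sumT k p                  ≤⟨ sum-map-mono-≤ (All.map (T₀≤#F k∣p-1) D∣k) ⟩
  sum (map (length ∘ F) D)  ≡⟨ length-concatMap F D ⟨
  length (concatMap F D)    ≤⟨ Unique-⊆⇒length-≤ (Unique-concatMap D-Unique F-Unique F-separated)
                                                  (concatMap-⊆ F⊆X) ⟩
  length (X k p)            ∎
  where
  open ≤-Reasoning
  open DivisorImages p k
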